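{- Let $n,m\ge0$ be integers and let $z\in Y_{n+m}$. Then there exist unique elements $x\in Y_n$ and $y\in Y_m$ such that $x/y\le z\le x\backslash y$.
   Context: A planar binary tree of degree $n\ge 0$ is a planar rooted tree (up to planar isotopy) with $n+1$ leaves in which every internal vertex has exactly two inputs; $Y_n$ is the set of these trees, $Y_0=\{|\}$. For $x\in Y_p$, $y\in Y_q$ the grafting $x\vee y\in Y_{p+q+1}$ joins the roots of $x$ and $y$ to a new vertex with a new root; every $x\in Y_n$, $n\ge1$, decomposes uniquely as $x=x^l\vee x^r$. Each $Y_n$ carries the (Tamari) partial order $\le$: the smallest partial order such that $(a\vee b)\vee c\le a\vee(b\vee c)$ for all trees $a,b,c$, and $a\le b$ implies $a\vee c\le b\vee c$ and $c\vee a\le c\vee b$. For $x\in Y_p,y\in Y_q$, $x/y\in Y_{p+q}$ is obtained by identifying the root of $x$ with the leftmost leaf of $y$, and $x\backslash y\in Y_{p+q}$ by identifying the rightmost leaf of $x$ with the root of $y$ (recursively: $x/|=x$, $x/(y^l\vee y^r)=(x/y^l)\vee y^r$, $|\backslash y=y$, $(x^l\vee x^r)\backslash y=x^l\vee(x^r\backslash y)$). -}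

module Defs where

open import Data.Nat using (ℕ; zero; suc; _+_)

-- Planar binary trees: leaf is the trivial tree |, node x y is the grafting x ∨ y.
data Tree : Set where
  leaf : Tree
  _∨_  : Tree → Tree → Tree

infixr 5 _∨_

-- degree = number of internal vertices (so a tree of degree n has n+1 leaves)
deg : Tree → ℕ
deg leaf    = zero
deg (l ∨ r) = suc (deg l + deg r)

-- x / y : identify the root of x with the leftmost leaf of y
_/_ : Tree → Tree → Tree
x / leaf    = x
x / (l ∨ r) = (x / l) ∨ r

-- x \ y : identify the rightmost leaf of x with the root of y
_\\_ : Tree → Tree → Tree
leaf    \\ y = y
(l ∨ r) \\ y = l ∨ (r \\ y)

data _≤T_ : Tree → Tree → Set where
  ≤-refl  : ∀ {a} → a ≤T a
  ≤-trans : ∀ {a b c} → a ≤T b → b ≤T c → a ≤T c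
  ≤-assoc : ∀ {a b c} → ((a ∨ b) ∨ c) ≤T (a ∨ (b ∨ c))
  ≤-left  : ∀ {a b c} → a ≤T b → (a ∨ c) ≤T (b ∨ c)
  ≤-right : ∀ {a b c} → a ≤T b → (c ∨ a) ≤T (c ∨ b)

-- Cutting z after its first n internal vertices (in in-order) gives a pair split n z = (x , y)
-- with x / y ≤ z ≤ x \\ y. The map split n is monotone for the Tamari order and sends both
-- x / y and x \\ y back to (x , y); so any (x′ , y′) with x′ / y′ ≤ z ≤ x′ \\ y′ satisfies
-- (x′ , y′) ≤ split n z ≤ (x′ , y′), and antisymmetry of the Tamari order forces equality.
-- Antisymmetry holds because the total size of right subtrees strictly increases under rotation.
module Submission where

open import Defs
open import Data.Nat using (ℕ; suc; _+_; _≤_; _≰_; _<_; _≤?_; z≤n; s≤s)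
open import Data.Nat.Properties
  using (+-suc; +-assoc; +-identityʳ; suc-injective; +-cancelˡ-≡; +-cancelˡ-≤; m≤m+n;
         m+n≤o⇒m≤o; m≤n⇒m≤1+n; m≤n⇒m≤n+o; +-monoʳ-≤; 1+n≰n; ≰⇒>; m≤n⇒∃[o]m+o≡n;
         n≤0⇒n≡0; +-monoˡ-<; +-monoʳ-<; <-trans; <-asym)
open import Data.Nat.Solver using (module +-*-Solver)
open import Data.Product using (Σ; ∃; _×_; _,_; proj₁; proj₂; map₁; map₂)
open import Data.Product.Relation.Binary.Pointwise.NonDependent using (Pointwise)
open import Data.Sum using (_⊎_; inj₁; inj₂; [_,_]′)
open import Data.Empty using (⊥-elim)
open import Relation.Nullary using (yes; no)
open import Relation.Binary.PropositionalEquality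
  using (_≡_; refl; sym; trans; cong; cong₂; subst; subst₂; module ≡-Reasoning)

deg-resp-≤T : ∀ {a b} → a ≤T b → deg a ≡ deg b
deg-resp-≤T ≤-refl        = refl
deg-resp-≤T (≤-trans p q) = trans (deg-resp-≤T p) (deg-resp-≤T q)
deg-resp-≤T (≤-assoc {a} {b} {c}) =
  cong suc (trans (cong (_+ deg c) (sym (+-suc (deg a) (deg b)))) (+-assoc (deg a) (suc (deg b)) (deg c)))
deg-resp-≤T (≤-left  {c = c} p) = cong (λ d → suc (d + deg c)) (deg-resp-≤T p)
deg-resp-≤T (≤-right {c = c} p) = cong (λ d → suc (deg c + d)) (deg-resp-≤T p)

deg-/ : ∀ x y → deg (x / y) ≡ deg x + deg y
deg-/ x leaf    = sym (+-identityʳ (deg x))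
deg-/ x (l ∨ r) = trans (cong (λ d → suc (d + deg r)) (deg-/ x l))
  (trans (cong suc (+-assoc (deg x) (deg l) (deg r))) (sym (+-suc (deg x) (deg l + deg r))))

rightWeight : Tree → ℕ
rightWeight leaf    = 0
rightWeight (l ∨ r) = rightWeight l + (rightWeight r + deg r)

rightWeight-rotate : ∀ a b c →
  rightWeight (a ∨ (b ∨ c)) ≡ suc (rightWeight ((a ∨ b) ∨ c) + deg c)
rightWeight-rotate a b c =
  solve 5 (λ A B C db dc → A :+ ((B :+ (C :+ dc)) :+ (con 1 :+ (db :+ dc)))
                      := con 1 :+ ((A :+ (B :+ db)) :+ (C :+ dc) :+ dc))
    refl (rightWeight a) (rightWeight b) (rightWeight c) (deg b) (deg c)
  where open +-*-Solver

≤T⇒≡⊎rightWeight< : ∀ {a b} → a ≤T b → a ≡ b ⊎ rightWeight a < rightWeight b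
≤T⇒≡⊎rightWeight< ≤-refl = inj₁ refl
≤T⇒≡⊎rightWeight< (≤-trans p q) with ≤T⇒≡⊎rightWeight< p | ≤T⇒≡⊎rightWeight< q
... | inj₁ refl | q′       = q′
... | inj₂ lt   | inj₁ refl = inj₂ lt
... | inj₂ lt   | inj₂ lt′  = inj₂ (<-trans lt lt′)
≤T⇒≡⊎rightWeight< (≤-assoc {a} {b} {c}) rewrite rightWeight-rotate a b c =
  inj₂ (s≤s (m≤m+n _ (deg c)))
≤T⇒≡⊎rightWeight< (≤-left {c = c} p) with ≤T⇒≡⊎rightWeight< p
... | inj₁ refl = inj₁ refl
... | inj₂ lt   = inj₂ (+-monoˡ-< (rightWeight c + deg c) lt)
≤T⇒≡⊎rightWeight< (≤-right {b = b} {c} p) with ≤T⇒≡⊎rightWeight< p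
... | inj₁ refl = inj₁ refl
... | inj₂ lt rewrite deg-resp-≤T p = inj₂ (+-monoʳ-< (rightWeight c) (+-monoˡ-< (deg b) lt))

≤T-antisym : ∀ {a b} → a ≤T b → b ≤T a → a ≡ b
≤T-antisym p q with ≤T⇒≡⊎rightWeight< p | ≤T⇒≡⊎rightWeight< q
... | inj₁ a≡b | _        = a≡b
... | inj₂ _   | inj₁ b≡a = sym b≡a
... | inj₂ lt  | inj₂ lt′ = ⊥-elim (<-asym lt lt′)

∨-/-≤T : ∀ x y w → ((x ∨ y) / w) ≤T (x ∨ (y / w))
∨-/-≤T x y leaf    = ≤-refl
∨-/-≤T x y (l ∨ r) = ≤-trans (≤-left (∨-/-≤T x y l)) ≤-assoc

∨-\\-≤T : ∀ x y w → ((x \\ y) ∨ w) ≤T (x \\ (y ∨ w))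
∨-\\-≤T leaf    y w = ≤-refl
∨-\\-≤T (l ∨ r) y w = ≤-trans ≤-assoc (≤-right (∨-\\-≤T r y w))

n≤d⊎∃[k]1+d+k≡n : ∀ n d → n ≤ d ⊎ ∃ λ k → suc (d + k) ≡ n
n≤d⊎∃[k]1+d+k≡n n d with n ≤? d
... | yes n≤d = inj₁ n≤d
... | no  n≰d = inj₂ (m≤n⇒∃[o]m+o≡n (≰⇒> n≰d))

1+m+n≰m : ∀ m n → suc (m + n) ≰ m
1+m+n≰m m n h = 1+n≰n (m+n≤o⇒m≤o (suc m) h)

split : ℕ → Tree → Tree × Tree
split n leaf = leaf , leaf
split n (l ∨ r) with n≤d⊎∃[k]1+d+k≡n n (deg l)
... | inj₁ _       = map₂ (_∨ r) (split n l)
... | inj₂ (k , _) = map₁ (l ∨_) (split k r)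

split-∨ˡ : ∀ {n} l r → n ≤ deg l → split n (l ∨ r) ≡ map₂ (_∨ r) (split n l)
split-∨ˡ {n} l r n≤l with n≤d⊎∃[k]1+d+k≡n n (deg l)
... | inj₁ _        = refl
... | inj₂ (k , refl) = ⊥-elim (1+m+n≰m (deg l) k n≤l)

split-∨ʳ : ∀ {n} l r k → suc (deg l + k) ≡ n → split n (l ∨ r) ≡ map₁ (l ∨_) (split k r)
split-∨ʳ l r k refl with n≤d⊎∃[k]1+d+k≡n (suc (deg l + k)) (deg l)
... | inj₁ n≤l = ⊥-elim (1+m+n≰m (deg l) k n≤l)
... | inj₂ (k′ , eq) rewrite +-cancelˡ-≡ (deg l) k′ k (suc-injective eq) = refl

split-bounds : ∀ n z → let (x , y) = split n z in (x / y) ≤T z × z ≤T (x \\ y)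
split-bounds n leaf = ≤-refl , ≤-refl
split-bounds n (l ∨ r) with n≤d⊎∃[k]1+d+k≡n n (deg l)
... | inj₁ _ = let (lo , hi) = split-bounds n l
                   (x , y) = split n l
               in ≤-left lo , ≤-trans (≤-left hi) (∨-\\-≤T x y r)
... | inj₂ (k , _) = let (lo , hi) = split-bounds k r
                         (x , y) = split k r
                     in ≤-trans (∨-/-≤T l x y) (≤-right lo) , ≤-right hi

split-deg : ∀ n z → n ≤ deg z → deg (proj₁ (split n z)) ≡ n
split-deg n leaf n≤0 = sym (n≤0⇒n≡0 n≤0)
split-deg n (l ∨ r) n≤z with n≤d⊎∃[k]1+d+k≡n n (deg l)
... | inj₁ n≤l = split-deg n l n≤l
... | inj₂ (k , refl) =
  cong (λ d → suc (deg l + d)) (split-deg k r (+-cancelˡ-≤ (suc (deg l)) k (deg r) n≤z))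

split-deg-self : ∀ x → split (deg x) x ≡ (x , leaf)
split-deg-self leaf    = refl
split-deg-self (l ∨ r) rewrite split-∨ʳ l r (deg r) refl | split-deg-self r = refl

split-/ : ∀ x y → split (deg x) (x / y) ≡ (x , y)
split-/ x leaf = split-deg-self x
split-/ x (l ∨ r)
  rewrite split-∨ˡ (x / l) r (subst (deg x ≤_) (sym (deg-/ x l)) (m≤m+n (deg x) (deg l)))
        | split-/ x l = refl

split-zero : ∀ y → split 0 y ≡ (leaf , y)
split-zero leaf    = refl
split-zero (l ∨ r) rewrite split-∨ˡ l r z≤n | split-zero l = refl

split-\\ : ∀ x y → split (deg x) (x \\ y) ≡ (x , y)
split-\\ leaf    y = split-zero y
split-\\ (l ∨ r) y rewrite split-∨ʳ l (r \\ y) (deg r) refl | split-\\ r y = refl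

infix 4 _≤T²_
_≤T²_ : Tree × Tree → Tree × Tree → Set
_≤T²_ = Pointwise _≤T_ _≤T_

split-mono : ∀ n {a b} → a ≤T b → split n a ≤T² split n b
split-mono n ≤-refl        = ≤-refl , ≤-refl
split-mono n (≤-trans p q) =
  let (lo , hi) = split-mono n p ; (lo′ , hi′) = split-mono n q in ≤-trans lo lo′ , ≤-trans hi hi′
split-mono n (≤-left {a} {b} {c} p) = [ cutInLeft , cutInRight ]′ (n≤d⊎∃[k]1+d+k≡n n (deg a))
  where
  a≡b : deg a ≡ deg b
  a≡b = deg-resp-≤T p
  cutInLeft : n ≤ deg a → split n (a ∨ c) ≤T² split n (b ∨ c)
  cutInLeft n≤a = let (lo , hi) = split-mono n p in
    subst₂ _≤T²_ (sym (split-∨ˡ a c n≤a)) (sym (split-∨ˡ b c (subst (n ≤_) a≡b n≤a)))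
      (lo , ≤-left hi)
  cutInRight : ∃ (λ k → suc (deg a + k) ≡ n) → split n (a ∨ c) ≤T² split n (b ∨ c)
  cutInRight (k , eq) =
    subst₂ _≤T²_ (sym (split-∨ʳ a c k eq)) (sym (split-∨ʳ b c k (subst (λ d → suc (d + k) ≡ n) a≡b eq)))
      (≤-left p , ≤-refl)
split-mono n (≤-right {a} {b} {c} p) = [ cutInLeft , cutInRight ]′ (n≤d⊎∃[k]1+d+k≡n n (deg c))
  where
  cutInLeft : n ≤ deg c → split n (c ∨ a) ≤T² split n (c ∨ b)
  cutInLeft n≤c = subst₂ _≤T²_ (sym (split-∨ˡ c a n≤c)) (sym (split-∨ˡ c b n≤c)) (≤-refl , ≤-right p)
  cutInRight : ∃ (λ k → suc (deg c + k) ≡ n) → split n (c ∨ a) ≤T² split n (c ∨ b)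
  cutInRight (k , eq) = let (lo , hi) = split-mono k p in
    subst₂ _≤T²_ (sym (split-∨ʳ c a k eq)) (sym (split-∨ʳ c b k eq)) (≤-right lo , hi)
split-mono n (≤-assoc {p} {q} {s}) = [ cutInP , cutBeyondP ]′ (n≤d⊎∃[k]1+d+k≡n n (deg p))
  where
  cutInP : n ≤ deg p → split n ((p ∨ q) ∨ s) ≤T² split n (p ∨ (q ∨ s))
  cutInP n≤p = subst₂ _≤T²_ (sym onLeftAssoc) (sym (split-∨ˡ p (q ∨ s) n≤p)) (≤-refl , ≤-assoc)
    where
    onLeftAssoc : split n ((p ∨ q) ∨ s) ≡ map₂ (_∨ s) (map₂ (_∨ q) (split n p))
    onLeftAssoc = trans (split-∨ˡ (p ∨ q) s (m≤n⇒m≤1+n (m≤n⇒m≤n+o (deg q) n≤p)))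
                    (cong (map₂ (_∨ s)) (split-∨ˡ p q n≤p))
  cutInQ : ∀ k → suc (deg p + k) ≡ n → k ≤ deg q → split n ((p ∨ q) ∨ s) ≤T² split n (p ∨ (q ∨ s))
  cutInQ k eq k≤q = subst₂ _≤T²_ (sym onLeftAssoc) (sym onRightAssoc) (≤-refl , ≤-refl)
    where
    onLeftAssoc : split n ((p ∨ q) ∨ s) ≡ map₂ (_∨ s) (map₁ (p ∨_) (split k q))
    onLeftAssoc = trans (split-∨ˡ (p ∨ q) s (subst (_≤ deg (p ∨ q)) eq (s≤s (+-monoʳ-≤ (deg p) k≤q))))
                    (cong (map₂ (_∨ s)) (split-∨ʳ p q k eq))
    onRightAssoc : split n (p ∨ (q ∨ s)) ≡ map₁ (p ∨_) (map₂ (_∨ s) (split k q))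
    onRightAssoc = trans (split-∨ʳ p (q ∨ s) k eq) (cong (map₁ (p ∨_)) (split-∨ˡ q s k≤q))
  cutInS : ∀ k j → suc (deg p + k) ≡ n → suc (deg q + j) ≡ k →
        split n ((p ∨ q) ∨ s) ≤T² split n (p ∨ (q ∨ s))
  cutInS k j refl refl = subst₂ _≤T²_ (sym onLeftAssoc) (sym onRightAssoc) (≤-assoc , ≤-refl)
    where
    onLeftAssoc : split (suc (deg p + suc (deg q + j))) ((p ∨ q) ∨ s) ≡ map₁ ((p ∨ q) ∨_) (split j s)
    onLeftAssoc = split-∨ʳ (p ∨ q) s j
      (cong suc (trans (cong suc (+-assoc (deg p) (deg q) j)) (sym (+-suc (deg p) (deg q + j)))))
    onRightAssoc : split (suc (deg p + suc (deg q + j))) (p ∨ (q ∨ s))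
                 ≡ map₁ (p ∨_) (map₁ (q ∨_) (split j s))
    onRightAssoc = trans (split-∨ʳ p (q ∨ s) (suc (deg q + j)) refl)
                         (cong (map₁ (p ∨_)) (split-∨ʳ q s j refl))
  cutBeyondP : ∃ (λ k → suc (deg p + k) ≡ n) → split n ((p ∨ q) ∨ s) ≤T² split n (p ∨ (q ∨ s))
  cutBeyondP (k , eq) =
    [ cutInQ k eq , (λ (j , eq′) → cutInS k j eq eq′) ]′ (n≤d⊎∃[k]1+d+k≡n k (deg q))

split-squeeze : ∀ {x y z} → (x / y) ≤T z → z ≤T (x \\ y) → split (deg x) z ≡ (x , y)
split-squeeze {x} {y} {z} lo hi =
  let (x≤ , y≤) = subst (_≤T² split (deg x) z) (split-/ x y) (split-mono (deg x) lo)
      (≤x , ≤y) = subst (split (deg x) z ≤T²_) (split-\\ x y) (split-mono (deg x) hi)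
  in cong₂ _,_ (≤T-antisym ≤x x≤) (≤T-antisym ≤y y≤)

corollary2p4 : (n m : ℕ) (z : Tree) → deg z ≡ n + m →
    Σ Tree (λ x → Σ Tree (λ y →
      (deg x ≡ n × deg y ≡ m × (x / y) ≤T z × z ≤T (x \\ y)) ×
      ((x′ y′ : Tree) → deg x′ ≡ n → deg y′ ≡ m → (x′ / y′) ≤T z → z ≤T (x′ \\ y′) →
        (x′ ≡ x × y′ ≡ y))))
corollary2p4 n m z deg-z = x , y , (deg-x , deg-y , split-bounds n z) , unique
  where
  x y : Tree
  x = proj₁ (split n z)
  y = proj₂ (split n z)
  deg-x : deg x ≡ n
  deg-x = split-deg n z (subst (n ≤_) (sym deg-z) (m≤m+n n m))
  deg-y : deg y ≡ m
  deg-y = +-cancelˡ-≡ n (deg y) m (begin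
    n + deg y     ≡⟨ cong (_+ deg y) (sym deg-x) ⟩
    deg x + deg y ≡⟨ sym (deg-/ x y) ⟩
    deg (x / y)   ≡⟨ deg-resp-≤T (proj₁ (split-bounds n z)) ⟩
    deg z         ≡⟨ deg-z ⟩
    n + m         ∎)
    where open ≡-Reasoning
  unique : (x′ y′ : Tree) → deg x′ ≡ n → deg y′ ≡ m → (x′ / y′) ≤T z → z ≤T (x′ \\ y′) →
           x′ ≡ x × y′ ≡ y
  unique x′ y′ deg-x′ _ lo hi =
    let split≡ = subst (λ d → split d z ≡ (x′ , y′)) deg-x′ (split-squeeze lo hi)
    in cong proj₁ (sym split≡) , cong proj₂ (sym split≡)
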